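{- Let $t\ge 3$ and $n\ge 2t+17$ be integers, and let $H$ be a 3-graph on $n$ vertices with $\delta_1(H)\ge g(n,t)$, where $$g(n,t)=\begin{cases}\frac{t-1}{2}n+\frac32 t^3-\frac92 t+6 & t \text{ odd},\\ \frac{t-2}{2}n+\frac32 t^3-\frac52 t+6 & t\text{ even}.\end{cases}$$ If $H$ contains no linear path of length $t+1$, then $H$ contains no copy of $C_{t+1}^+$ as a subgraph.
   Context: A 3-graph is a simple 3-uniform hypergraph; $\delta_1(H)$ is the minimum over vertices of the number of edges containing the vertex. A linear path of length $k$ is a collection of $k$ edges $e_1,\dots,e_k$ with $|e_i\cap e_j|=1$ if $|i-j|=1$ and $e_i\cap e_j=\emptyset$ otherwise. A linear cycle of length $k$, $C_k$, is a collection of $k$ edges $e_1,\dots,e_k$ with $|e_i\cap e_j|=1$ if $|i-j|\in\{1,k-1\}$ and $e_i\cap e_j=\emptyset$ otherwise. $C_k^+$ (a $k$-cycle with a parallel edge) is obtained from $C_k$ by adding a new vertex $v$ and an edge $f$ with $v\in f$ such that there is an edge $e\in C_k$ with $|f\cap e|=2$ and $(C_k\setminus\{e\})\cup\{f\}$ is also a linear cycle of length $k$. -}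

module Defs where

open import Data.Nat using (ℕ; zero; suc; _+_; _*_; _∸_; _^_; _≤_; _<_; _%_)
open import Data.Fin using (Fin; toℕ)
import Data.Fin as F
open import Data.Fin.Subset using (Subset; _∈_; _∉_; _∩_; ∣_∣)
open import Data.Fin.Subset.Properties using (_∈?_)
open import Data.List using (List; length; filter)
open import Data.List.Relation.Unary.All using (All)
open import Data.List.Relation.Unary.Unique.Propositional using (Unique)
import Data.List.Membership.Propositional as LM
open import Data.Product using (Σ; _×_; ∃)
open import Data.Sum using (_⊎_)
open import Relation.Nullary using (¬_; yes; no)
open import Relation.Binary.PropositionalEquality using (_≡_)

record Graph3 (n : ℕ) : Set where
  field
    edges  : List (Subset n)
    size3  : All (λ e → ∣ e ∣ ≡ 3) edges
    simple : Unique edges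
open Graph3 public

_∈E_ : ∀ {n} → Subset n → Graph3 n → Set
e ∈E H = e LM.∈ edges H

deg : ∀ {n} → Graph3 n → Fin n → ℕ
deg H v = length (filter (λ e → v ∈? e) (edges H))

-- twice g(n,t) (so that everything is a natural number)
g2 : ℕ → ℕ → ℕ
g2 n t with t % 2
... | 1 = (t ∸ 1) * n + 3 * t ^ 3 ∸ 9 * t + 12
... | _ = (t ∸ 2) * n + 3 * t ^ 3 ∸ 5 * t + 12

-- index adjacency in a path / cycle of length k (for toℕ i < toℕ j)
PathAdj : ℕ → ℕ → Set
PathAdj i j = j ≡ suc i

CycAdj : ℕ → ℕ → ℕ → Set
CycAdj k i j = (j ≡ suc i) ⊎ ((i ≡ 0) × (j ≡ k ∸ 1))

IsLinearPath : ∀ {n} k → (Fin k → Subset n) → Set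
IsLinearPath k p = ∀ i j → toℕ i < toℕ j →
  (PathAdj (toℕ i) (toℕ j) → ∣ p i ∩ p j ∣ ≡ 1) ×
  (¬ PathAdj (toℕ i) (toℕ j) → ∣ p i ∩ p j ∣ ≡ 0)

IsLinearCycle : ∀ {n} k → (Fin k → Subset n) → Set
IsLinearCycle k c = ∀ i j → toℕ i < toℕ j →
  (CycAdj k (toℕ i) (toℕ j) → ∣ c i ∩ c j ∣ ≡ 1) ×
  (¬ CycAdj k (toℕ i) (toℕ j) → ∣ c i ∩ c j ∣ ≡ 0)

replace : ∀ {n k} → (Fin k → Subset n) → Fin k → Subset n → Fin k → Subset n
replace c m f i with i F.≟ m
... | yes _ = f
... | no _  = c i

HasLinearPath : ∀ {n} → Graph3 n → ℕ → Set
HasLinearPath H k = Σ (Fin k → Subset _) λ p →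
  (∀ i → p i ∈E H) × IsLinearPath k p

HasLinearCycle : ∀ {n} → Graph3 n → ℕ → Set
HasLinearCycle H k = Σ (Fin k → Subset _) λ c →
  (∀ i → c i ∈E H) × IsLinearCycle k c

-- H contains a copy of C_k^+ : a linear k-cycle c in H, and an edge f of H
-- containing a vertex v outside all edges of c, such that for some edge c m,
-- |f ∩ c m| = 2 and replacing c m by f again gives a linear k-cycle.
HasCplus : ∀ {n} → Graph3 n → ℕ → Set
HasCplus {n} H k = Σ (Fin k → Subset n) λ c → Σ (Subset n) λ f →
  Σ (Fin n) λ v → Σ (Fin k) λ m →
    (∀ i → c i ∈E H) × IsLinearCycle k c ×
    f ∈E H × v ∈ f × (∀ i → v ∉ c i) ×
    ∣ f ∩ c m ∣ ≡ 2 × IsLinearCycle k (replace c m f)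

-- Let c be the linear (t+1)-cycle of a copy of C⁺_{t+1} in H, V its vertex set, and v the vertex of
-- the parallel edge f outside V. An edge g ∋ v with |g ∩ V| = 1, say g ∩ V = {x}, extends to a linear
-- path of length t+1: follow g by the t cycle edges starting at an edge through x and moving away
-- from the other one. If g ∩ V = ∅, the same applies to the cycle c′ in which f replaces the cycle
-- edge it meets in two vertices, since c′ meets g only in v. So every edge at v is v together with
-- a pair from V, and as consecutive cycle edges overlap, |V| ≤ 2t + 3. Hence
-- 2 deg(v) ≤ (2t+3)(2t+2) < (2t+3)² < 2 g(n, t), contradicting δ₁(H) ≥ g(n, t).
module Submission where

open import Defs

open import Data.Nat using (ℕ; zero; suc; _+_; _*_; _^_; _∸_; _≤_; _<_; z≤n; s≤s; s≤s⁻¹; _<?_; _≟_; _%_)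
open import Data.Nat.Properties
open import Data.Nat.DivMod
  using (_mod_; m%n<n; m<n⇒m%n≡m; %-distribˡ-+; m%n%n≡m%n; m≤n⇒[n∸m]%m≡n%m; n%n≡0)
open import Data.Nat.Combinatorics using (_C_; nC1≡n; nCk+nC[k+1]≡[n+1]C[k+1])
open import Data.Fin using (Fin; zero; suc; toℕ)
import Data.Fin.Properties as Fin
open import Data.Fin.Subset
open import Data.Fin.Subset.Properties
open import Data.Vec using ([]; _∷_; here; there)
open import Data.List using (List; []; _∷_; length; map; filter)
open import Data.List.Relation.Unary.All as All using (All; []; _∷_)
import Data.List.Relation.Unary.All.Properties as All
open import Data.List.Relation.Unary.Any using (here; there)
open import Data.List.Relation.Unary.AllPairs using ([]; _∷_)
open import Data.List.Relation.Unary.Unique.Propositional using (Unique)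
open import Data.List.Relation.Unary.Unique.Propositional.Properties using (filter⁺)
open import Data.List.Membership.Propositional.Properties using (∈-filter⁻)
open import Data.List.Properties using (length-map)
import Data.List.Membership.Propositional as List
open import Data.Product using (∃; _×_; _,_; proj₁; proj₂)
open import Data.Sum using (_⊎_; inj₁; inj₂)
open import Relation.Nullary using (¬_; yes; no; contradiction)
open import Relation.Binary.PropositionalEquality
open import Function using (_∘_; id)
open import Data.Nat.Tactic.RingSolver using (solve-∀)

private variable
  n : ℕ
  p q : Subset n
  x y : Fin n

∣p∣≡∣p∩q∣+∣p─q∣ : ∀ (p q : Subset n) → ∣ p ∣ ≡ ∣ p ∩ q ∣ + ∣ p ─ q ∣
∣p∣≡∣p∩q∣+∣p─q∣ []            []            = refl
∣p∣≡∣p∩q∣+∣p─q∣ (inside  ∷ p) (inside  ∷ q) = cong suc (∣p∣≡∣p∩q∣+∣p─q∣ p q)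
∣p∣≡∣p∩q∣+∣p─q∣ (inside  ∷ p) (outside ∷ q) =
  trans (cong suc (∣p∣≡∣p∩q∣+∣p─q∣ p q)) (sym (+-suc _ _))
∣p∣≡∣p∩q∣+∣p─q∣ (outside ∷ p) (inside  ∷ q) = ∣p∣≡∣p∩q∣+∣p─q∣ p q
∣p∣≡∣p∩q∣+∣p─q∣ (outside ∷ p) (outside ∷ q) = ∣p∣≡∣p∩q∣+∣p─q∣ p q

∣p∪q∣+∣p∩q∣≡∣p∣+∣q∣ : ∀ (p q : Subset n) → ∣ p ∪ q ∣ + ∣ p ∩ q ∣ ≡ ∣ p ∣ + ∣ q ∣
∣p∪q∣+∣p∩q∣≡∣p∣+∣q∣ []            []            = refl
∣p∪q∣+∣p∩q∣≡∣p∣+∣q∣ (inside  ∷ p) (inside  ∷ q) = cong suc (begin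
  ∣ p ∪ q ∣ + suc ∣ p ∩ q ∣ ≡⟨ +-suc _ _ ⟩
  suc (∣ p ∪ q ∣ + ∣ p ∩ q ∣) ≡⟨ cong suc (∣p∪q∣+∣p∩q∣≡∣p∣+∣q∣ p q) ⟩
  suc (∣ p ∣ + ∣ q ∣)         ≡⟨ +-suc _ _ ⟨
  ∣ p ∣ + suc ∣ q ∣           ∎)
  where open ≡-Reasoning
∣p∪q∣+∣p∩q∣≡∣p∣+∣q∣ (inside  ∷ p) (outside ∷ q) = cong suc (∣p∪q∣+∣p∩q∣≡∣p∣+∣q∣ p q)
∣p∪q∣+∣p∩q∣≡∣p∣+∣q∣ (outside ∷ p) (inside  ∷ q) =
  trans (cong suc (∣p∪q∣+∣p∩q∣≡∣p∣+∣q∣ p q)) (sym (+-suc _ _))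
∣p∪q∣+∣p∩q∣≡∣p∣+∣q∣ (outside ∷ p) (outside ∷ q) = ∣p∪q∣+∣p∩q∣≡∣p∣+∣q∣ p q

∣p∣≡0⇒x∉p : ∣ p ∣ ≡ 0 → x ∉ p
∣p∣≡0⇒x∉p {p = p} {x} ∣p∣≡0 x∈p = n≮0 (subst (∣ p - x ∣ <_) ∣p∣≡0 (x∈p⇒∣p-x∣<∣p∣ x∈p))

Empty⇒∣p∣≡0 : Empty p → ∣ p ∣ ≡ 0
Empty⇒∣p∣≡0 {n} empty = trans (cong ∣_∣ (Empty-unique empty)) (∣⊥∣≡0 n)

∣p∣≡1⇒x∈p⇒y∈p⇒x≡y : ∣ p ∣ ≡ 1 → x ∈ p → y ∈ p → x ≡ y
∣p∣≡1⇒x∈p⇒y∈p⇒x≡y {p = p} {x} {y} ∣p∣≡1 x∈p y∈p with y Fin.≟ x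
... | yes y≡x = sym y≡x
... | no  y≢x = contradiction (x∈p∧x≢y⇒x∈p-y y∈p y≢x) (∣p∣≡0⇒x∉p ∣p-x∣≡0)
  where
  ∣p-x∣≡0 : ∣ p - x ∣ ≡ 0
  ∣p-x∣≡0 = n<1⇒n≡0 (subst (∣ p - x ∣ <_) ∣p∣≡1 (x∈p⇒∣p-x∣<∣p∣ x∈p))

∣p∣≡1⇒Nonempty : ∣ p ∣ ≡ 1 → Nonempty p
∣p∣≡1⇒Nonempty {p = p} ∣p∣≡1 with nonempty? p
... | yes ne    = ne
... | no  empty = contradiction (trans (sym ∣p∣≡1) (Empty⇒∣p∣≡0 empty)) λ ()

p⊆⁅x⁆∧x∈p⇒∣p∣≡1 : p ⊆ ⁅ x ⁆ → x ∈ p → ∣ p ∣ ≡ 1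
p⊆⁅x⁆∧x∈p⇒∣p∣≡1 {x = x} p⊆⁅x⁆ x∈p = trans
  (cong ∣_∣ (⊆-antisym p⊆⁅x⁆ (λ y∈⁅x⁆ → subst (_∈ _) (sym (x∈⁅y⁆⇒x≡y _ y∈⁅x⁆)) x∈p)))
  (∣⁅x⁆∣≡1 x)

∣e∩q∣≡2⇒∣e─q∣≡1 : ∀ (e q : Subset n) → ∣ e ∣ ≡ 3 → ∣ e ∩ q ∣ ≡ 2 → ∣ e ─ q ∣ ≡ 1
∣e∩q∣≡2⇒∣e─q∣≡1 e q ∣e∣≡3 ∣e∩q∣≡2 =
  +-cancelˡ-≡ 2 _ _ (trans (cong (_+ ∣ e ─ q ∣) (sym ∣e∩q∣≡2)) (trans (sym (∣p∣≡∣p∩q∣+∣p─q∣ e q)) ∣e∣≡3))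

∣p─q∣≡1⇒p⊆q∪⁅x⁆ : ∣ p ─ q ∣ ≡ 1 → x ∈ p → x ∉ q → p ⊆ q ∪ ⁅ x ⁆
∣p─q∣≡1⇒p⊆q∪⁅x⁆ {q = q} {x} ∣p─q∣≡1 x∈p x∉q {y} y∈p with y ∈? q
... | yes y∈q = x∈p∪q⁺ (inj₁ y∈q)
... | no  y∉q = x∈p∪q⁺ (inj₂ (subst (_∈ ⁅ x ⁆) (sym y≡x) (x∈⁅x⁆ x)))
  where
  y≡x : y ≡ x
  y≡x = ∣p∣≡1⇒x∈p⇒y∈p⇒x≡y ∣p─q∣≡1 (x∈p∧x∉q⇒x∈p─q y∈p y∉q) (x∈p∧x∉q⇒x∈p─q x∈p x∉q)

nCr≤[1+n]Cr : ∀ n r → n C r ≤ suc n C r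
nCr≤[1+n]Cr n zero    = ≤-refl
nCr≤[1+n]Cr n (suc r) = subst (n C suc r ≤_) (nCk+nC[k+1]≡[n+1]C[k+1] n r) (m≤n+m _ _)

C-monoˡ-≤ : ∀ r {m m'} → m ≤ m' → m C r ≤ m' C r
C-monoˡ-≤ r {m} {zero}   m≤0    = ≤-reflexive (cong (_C r) (n≤0⇒n≡0 m≤0))
C-monoˡ-≤ r {m} {suc m'} m≤1+m' with m ≟ suc m'
... | yes refl = ≤-refl
... | no  m≢1+m' = ≤-trans (C-monoˡ-≤ r (s≤s⁻¹ (≤∧≢⇒< m≤1+m' m≢1+m'))) (nCr≤[1+n]Cr m' r)

2*nC2+n≡n*n : ∀ n → 2 * (n C 2) + n ≡ n * n
2*nC2+n≡n*n zero    = refl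
2*nC2+n≡n*n (suc n) = begin
  2 * (suc n C 2) + suc n        ≡⟨ cong (λ m → 2 * m + suc n) (nCk+nC[k+1]≡[n+1]C[k+1] n 1) ⟨
  2 * (n C 1 + n C 2) + suc n    ≡⟨ cong (λ m → 2 * (m + n C 2) + suc n) (nC1≡n n) ⟩
  2 * (n + n C 2) + suc n        ≡⟨ regroup n (n C 2) ⟩
  (2 * (n C 2) + n) + (2 * n + 1) ≡⟨ cong (_+ (2 * n + 1)) (2*nC2+n≡n*n n) ⟩
  n * n + (2 * n + 1)            ≡⟨ square-suc n ⟩
  suc n * suc n                  ∎
  where
  open ≡-Reasoning
  regroup : ∀ n b → 2 * (n + b) + suc n ≡ (2 * b + n) + (2 * n + 1)
  regroup = solve-∀
  square-suc : ∀ n → n * n + (2 * n + 1) ≡ suc n * suc n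
  square-suc = solve-∀

Unique-map⁺-injectiveOn : ∀ {A B : Set} (f : A → B) {xs : List A} →
  (∀ {a b} → a List.∈ xs → b List.∈ xs → f a ≡ f b → a ≡ b) →
  Unique xs → Unique (map f xs)
Unique-map⁺-injectiveOn f {[]}     _   []         = []
Unique-map⁺-injectiveOn f {x ∷ xs} inj (x∉xs ∷ u) =
  All.map⁺ (All.tabulate λ y∈xs fx≡fy → All.lookup x∉xs y∈xs (inj (here refl) (there y∈xs) fx≡fy))
  ∷ Unique-map⁺-injectiveOn f (λ a∈xs b∈xs → inj (there a∈xs) (there b∈xs)) u

insideTails outsideTails : List (Subset (suc n)) → List (Subset n)
insideTails []                  = []
insideTails ((inside  ∷ s) ∷ xs) = s ∷ insideTails xs
insideTails ((outside ∷ s) ∷ xs) = insideTails xs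
outsideTails []                  = []
outsideTails ((inside  ∷ s) ∷ xs) = outsideTails xs
outsideTails ((outside ∷ s) ∷ xs) = s ∷ outsideTails xs

length-insideTails+outsideTails : ∀ (xs : List (Subset (suc n))) →
  length xs ≡ length (insideTails xs) + length (outsideTails xs)
length-insideTails+outsideTails [] = refl
length-insideTails+outsideTails ((inside  ∷ s) ∷ xs) =
  cong suc (length-insideTails+outsideTails xs)
length-insideTails+outsideTails ((outside ∷ s) ∷ xs) =
  trans (cong suc (length-insideTails+outsideTails xs)) (sym (+-suc _ _))

∈-insideTails⁻ : ∀ {s} (xs : List (Subset (suc n))) → s List.∈ insideTails xs → (inside ∷ s) List.∈ xs
∈-insideTails⁻ ((inside  ∷ s) ∷ xs) (here refl) = here refl
∈-insideTails⁻ ((inside  ∷ s) ∷ xs) (there s∈)  = there (∈-insideTails⁻ xs s∈)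
∈-insideTails⁻ ((outside ∷ s) ∷ xs) s∈          = there (∈-insideTails⁻ xs s∈)

∈-outsideTails⁻ : ∀ {s} (xs : List (Subset (suc n))) → s List.∈ outsideTails xs → (outside ∷ s) List.∈ xs
∈-outsideTails⁻ ((outside ∷ s) ∷ xs) (here refl) = here refl
∈-outsideTails⁻ ((outside ∷ s) ∷ xs) (there s∈)  = there (∈-outsideTails⁻ xs s∈)
∈-outsideTails⁻ ((inside  ∷ s) ∷ xs) s∈          = there (∈-outsideTails⁻ xs s∈)

Unique-insideTails : ∀ (xs : List (Subset (suc n))) → Unique xs → Unique (insideTails xs)
Unique-insideTails [] [] = []
Unique-insideTails ((inside ∷ s) ∷ xs) (s∉xs ∷ u) =
  All.tabulate (λ t∈ s≡t → All.lookup s∉xs (∈-insideTails⁻ xs t∈) (cong (inside ∷_) s≡t))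
  ∷ Unique-insideTails xs u
Unique-insideTails ((outside ∷ s) ∷ xs) (_ ∷ u) = Unique-insideTails xs u

Unique-outsideTails : ∀ (xs : List (Subset (suc n))) → Unique xs → Unique (outsideTails xs)
Unique-outsideTails [] [] = []
Unique-outsideTails ((outside ∷ s) ∷ xs) (s∉xs ∷ u) =
  All.tabulate (λ t∈ s≡t → All.lookup s∉xs (∈-outsideTails⁻ xs t∈) (cong (outside ∷_) s≡t))
  ∷ Unique-outsideTails xs u
Unique-outsideTails ((inside ∷ s) ∷ xs) (_ ∷ u) = Unique-outsideTails xs u

SubsetOfSize : Subset n → ℕ → Subset n → Set
SubsetOfSize W r s = s ⊆ W × ∣ s ∣ ≡ r

SubsetOfSize-inside⁻ : ∀ {b} {W s : Subset n} {r} →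
  SubsetOfSize (b ∷ W) (suc r) (inside ∷ s) → SubsetOfSize W r s
SubsetOfSize-inside⁻ (⊆W , ∣s∣≡r) = drop-∷-⊆ ⊆W , suc-injective ∣s∣≡r

SubsetOfSize-outside⁻ : ∀ {b} {W s : Subset n} {r} →
  SubsetOfSize (b ∷ W) r (outside ∷ s) → SubsetOfSize W r s
SubsetOfSize-outside⁻ (⊆W , ∣s∣≡r) = drop-∷-⊆ ⊆W , ∣s∣≡r

All-insideTails⁺ : ∀ {P : Subset (suc n) → Set} (xs : List (Subset (suc n))) →
  All P xs → All (λ s → P (inside ∷ s)) (insideTails xs)
All-insideTails⁺ xs all = All.tabulate λ s∈ → All.lookup all (∈-insideTails⁻ xs s∈)

All-outsideTails⁺ : ∀ {P : Subset (suc n) → Set} (xs : List (Subset (suc n))) →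
  All P xs → All (λ s → P (outside ∷ s)) (outsideTails xs)
All-outsideTails⁺ xs all = All.tabulate λ s∈ → All.lookup all (∈-outsideTails⁻ xs s∈)

length≡length-outsideTails : ∀ {P : Subset (suc n) → Set} (xs : List (Subset (suc n))) →
  All P xs → (∀ {s} → ¬ P (inside ∷ s)) → length xs ≡ length (outsideTails xs)
length≡length-outsideTails []                   _        _  = refl
length≡length-outsideTails ((inside  ∷ s) ∷ xs) (p ∷ _)  ¬p = contradiction p ¬p
length≡length-outsideTails ((outside ∷ s) ∷ xs) (_ ∷ ps) ¬p = cong suc (length≡length-outsideTails xs ps ¬p)

inside∷p⊈outside∷q : ¬ (inside ∷ p ⊆ outside ∷ q)
inside∷p⊈outside∷q ⊆ with ⊆ here
... | ()

length≤∣W∣Cr : ∀ (W : Subset n) r (xs : List (Subset n)) → Unique xs →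
  All (SubsetOfSize W r) xs → length xs ≤ ∣ W ∣ C r
length≤∣W∣Cr-outsideTails : ∀ {b r} (W : Subset n) (xs : List (Subset (suc n))) → Unique xs →
  All (SubsetOfSize (b ∷ W) r) xs → length (outsideTails xs) ≤ ∣ W ∣ C r
length≤∣W∣Cr [] r [] _ _ = z≤n
length≤∣W∣Cr [] r ([] ∷ []) _ ((_ , refl) ∷ []) = ≤-refl
length≤∣W∣Cr [] r ([] ∷ [] ∷ _) (([]≢[] ∷ _) ∷ _) _ = contradiction refl []≢[]
length≤∣W∣Cr (inside ∷ W) zero xs u all = begin
  length xs                 ≡⟨ length≡length-outsideTails xs all (λ ()) ⟩
  length (outsideTails xs)  ≤⟨ length≤∣W∣Cr-outsideTails W xs u all ⟩
  ∣ W ∣ C 0                 ∎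
  where open ≤-Reasoning
length≤∣W∣Cr (inside ∷ W) (suc r) xs u all = begin
  length xs                                          ≡⟨ length-insideTails+outsideTails xs ⟩
  length (insideTails xs) + length (outsideTails xs) ≤⟨ +-mono-≤ inside-bound (length≤∣W∣Cr-outsideTails W xs u all) ⟩
  ∣ W ∣ C r + ∣ W ∣ C suc r                          ≡⟨ nCk+nC[k+1]≡[n+1]C[k+1] ∣ W ∣ r ⟩
  suc ∣ W ∣ C suc r                                  ∎
  where
  open ≤-Reasoning
  inside-bound : length (insideTails xs) ≤ ∣ W ∣ C r
  inside-bound = length≤∣W∣Cr W r (insideTails xs) (Unique-insideTails xs u)
    (All.map SubsetOfSize-inside⁻ (All-insideTails⁺ xs all))
length≤∣W∣Cr (outside ∷ W) r xs u all = begin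
  length xs                 ≡⟨ length≡length-outsideTails xs all (λ (⊆W , _) → inside∷p⊈outside∷q ⊆W) ⟩
  length (outsideTails xs)  ≤⟨ length≤∣W∣Cr-outsideTails W xs u all ⟩
  ∣ W ∣ C r                 ∎
  where open ≤-Reasoning

length≤∣W∣Cr-outsideTails {r = r} W xs u all = length≤∣W∣Cr W r (outsideTails xs) (Unique-outsideTails xs u)
  (All.map SubsetOfSize-outside⁻ (All-outsideTails⁺ xs all))

module LinearCycle {t : ℕ} (t≥3 : 3 ≤ t) (c : Fin (suc t) → Subset n)
                   (cyc : IsLinearCycle (suc t) c) where

  private
    k : ℕ
    k = suc t

  CycAdj⇒< : ∀ {i j} → CycAdj k i j → i < j
  CycAdj⇒< (inj₁ refl)          = n<1+n _
  CycAdj⇒< (inj₂ (refl , refl)) = <-≤-trans (s≤s z≤n) t≥3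

  ∣c∩c∣≡1 : ∀ i j → CycAdj k (toℕ i) (toℕ j) → ∣ c i ∩ c j ∣ ≡ 1
  ∣c∩c∣≡1 i j adj = proj₁ (cyc i j (CycAdj⇒< adj)) adj

  ∣c∩c∣≡0 : ∀ i j → toℕ i < toℕ j → ¬ CycAdj k (toℕ i) (toℕ j) → ∣ c i ∩ c j ∣ ≡ 0
  ∣c∩c∣≡0 i j i<j ¬adj = proj₂ (cyc i j i<j) ¬adj

  ¬CycAdj[A,A+d] : ∀ A d → 2 ≤ d → d < t → ¬ CycAdj k A (A + d)
  ¬CycAdj[A,A+d] A d 2≤d d<t (inj₁ A+d≡1+A) =
    <⇒≢ 2≤d (sym (+-cancelˡ-≡ A d 1 (trans A+d≡1+A (+-comm 1 A))))
  ¬CycAdj[A,A+d] A d 2≤d d<t (inj₂ (refl , d≡t)) = <⇒≢ d<t d≡t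

  -- B is the index reached from A by a step of d that wraps around the cycle.
  ¬CycAdj[B,A] : ∀ A B d → B + k ≡ A + d → 2 ≤ d → d < t → ¬ CycAdj k B A
  ¬CycAdj[B,A] A B d B+k≡A+d 2≤d d<t (inj₁ refl) =
    <⇒≢ d<t (sym (+-cancelˡ-≡ (suc B) t d (trans (sym (+-suc B t)) B+k≡A+d)))
  ¬CycAdj[B,A] A B d B+k≡A+d 2≤d d<t (inj₂ (refl , refl)) =
    <⇒≢ 2≤d (+-cancelˡ-≡ t 1 d (trans (+-comm t 1) B+k≡A+d))

  edge : ℕ → Subset n
  edge a = c (a mod k)

  toℕ-mod : ∀ a → toℕ (a mod k) ≡ a % k
  toℕ-mod a = Fin.toℕ-fromℕ< (m%n<n a k)

  edge-toℕ : ∀ i → edge (toℕ i) ≡ c i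
  edge-toℕ i = cong c (Fin.toℕ-injective (trans (toℕ-mod (toℕ i)) (m<n⇒m%n≡m (Fin.toℕ<n i))))

  [a+d]%k≡[a%k+d]%k : ∀ a d → (a + d) % k ≡ (a % k + d) % k
  [a+d]%k≡[a%k+d]%k a d = begin
    (a + d) % k                   ≡⟨ %-distribˡ-+ a d k ⟩
    (a % k + d % k) % k           ≡⟨ cong (λ m → (m + d % k) % k) (m%n%n≡m%n a k) ⟨
    (a % k % k + d % k) % k       ≡⟨ %-distribˡ-+ (a % k) d k ⟨
    (a % k + d) % k               ∎
    where open ≡-Reasoning

  [a+d]%k≡a%k+d : ∀ a d → a % k + d < k → (a + d) % k ≡ a % k + d
  [a+d]%k≡a%k+d a d fits = trans ([a+d]%k≡[a%k+d]%k a d) (m<n⇒m%n≡m fits)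

  [a+d]%k+k≡a%k+d : ∀ a d → d < k → k ≤ a % k + d → (a + d) % k + k ≡ a % k + d
  [a+d]%k+k≡a%k+d a d d<k wraps = begin
    (a + d) % k + k          ≡⟨ cong (_+ k) ([a+d]%k≡[a%k+d]%k a d) ⟩
    (a % k + d) % k + k      ≡⟨ cong (_+ k) (m≤n⇒[n∸m]%m≡n%m wraps) ⟨
    (a % k + d ∸ k) % k + k  ≡⟨ cong (_+ k) (m<n⇒m%n≡m (m<n+o⇒m∸n<o _ k (+-mono-< (m%n<n a k) d<k))) ⟩
    a % k + d ∸ k + k        ≡⟨ m∸n+n≡m wraps ⟩
    a % k + d                ∎
    where open ≡-Reasoning

  ∣edge∩edge[+1]∣≡1 : ∀ a → ∣ edge a ∩ edge (a + 1) ∣ ≡ 1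
  ∣edge∩edge[+1]∣≡1 a with a % k <? t
  ... | yes a%k<t = ∣c∩c∣≡1 (a mod k) ((a + 1) mod k) (inj₁ (begin
    toℕ ((a + 1) mod k)  ≡⟨ toℕ-mod (a + 1) ⟩
    (a + 1) % k          ≡⟨ [a+d]%k≡a%k+d a 1 (subst (_< k) (+-comm 1 (a % k)) (s≤s a%k<t)) ⟩
    a % k + 1            ≡⟨ +-comm (a % k) 1 ⟩
    suc (a % k)          ≡⟨ cong suc (toℕ-mod a) ⟨
    suc (toℕ (a mod k))  ∎))
    where open ≡-Reasoning
  ... | no  a%k≮t = trans (cong ∣_∣ (∩-comm (edge a) (edge (a + 1))))
    (∣c∩c∣≡1 ((a + 1) mod k) (a mod k) (inj₂ (wraps-to-0 , trans (toℕ-mod a) a%k≡t)))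
    where
    a%k≡t : a % k ≡ t
    a%k≡t = ≤-antisym (s≤s⁻¹ (m%n<n a k)) (≮⇒≥ a%k≮t)
    wraps-to-0 : toℕ ((a + 1) mod k) ≡ 0
    wraps-to-0 = begin
      toℕ ((a + 1) mod k)  ≡⟨ toℕ-mod (a + 1) ⟩
      (a + 1) % k          ≡⟨ [a+d]%k≡[a%k+d]%k a 1 ⟩
      (a % k + 1) % k      ≡⟨ cong (λ m → (m + 1) % k) a%k≡t ⟩
      (t + 1) % k          ≡⟨ cong (_% k) (+-comm t 1) ⟩
      k % k                ≡⟨ n%n≡0 k ⟩
      0                    ∎
      where open ≡-Reasoning

  ∣edge∩edge[+d]∣≡0 : ∀ a d → 2 ≤ d → d < t → ∣ edge a ∩ edge (a + d) ∣ ≡ 0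
  ∣edge∩edge[+d]∣≡0 a d 2≤d d<t with a % k + d <? k
  ... | yes fits = ∣c∩c∣≡0 (a mod k) ((a + d) mod k)
    (subst (toℕ (a mod k) <_) (sym j≡i+d) (m<m+n _ (<-trans (s≤s z≤n) 2≤d)))
    (subst (¬_ ∘ CycAdj k (toℕ (a mod k))) (sym j≡i+d) (¬CycAdj[A,A+d] _ d 2≤d d<t))
    where
    j≡i+d : toℕ ((a + d) mod k) ≡ toℕ (a mod k) + d
    j≡i+d = trans (toℕ-mod (a + d))
              (trans ([a+d]%k≡a%k+d a d fits) (cong (_+ d) (sym (toℕ-mod a))))
  ... | no  wraps = trans (cong ∣_∣ (∩-comm (edge a) (edge (a + d))))
    (∣c∩c∣≡0 ((a + d) mod k) (a mod k)
      (+-cancelʳ-< _ _ _ (subst (_< toℕ (a mod k) + k) (sym j+k≡i+d) (+-monoʳ-< _ d<k)))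
      (¬CycAdj[B,A] _ _ d j+k≡i+d 2≤d d<t))
    where
    d<k : d < k
    d<k = m<n⇒m<1+n d<t
    j+k≡i+d : toℕ ((a + d) mod k) + k ≡ toℕ (a mod k) + d
    j+k≡i+d = trans (cong (_+ k) (toℕ-mod (a + d)))
                (trans ([a+d]%k+k≡a%k+d a d d<k (≮⇒≥ wraps)) (cong (_+ d) (sym (toℕ-mod a))))

  verticesUpTo : ℕ → Subset n
  verticesUpTo zero    = edge 0
  verticesUpTo (suc j) = verticesUpTo j ∪ edge (suc j)

  vertices : Subset n
  vertices = verticesUpTo t

  edge⊆verticesUpTo : ∀ {a} j → a ≤ j → edge a ⊆ verticesUpTo j
  edge⊆verticesUpTo         zero    z≤n    = id
  edge⊆verticesUpTo {a} (suc j) a≤1+j with a ≟ suc j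
  ... | yes refl    = λ x∈ → x∈p∪q⁺ (inj₂ x∈)
  ... | no  a≢1+j = λ x∈ → x∈p∪q⁺ (inj₁ (edge⊆verticesUpTo j (s≤s⁻¹ (≤∧≢⇒< a≤1+j a≢1+j)) x∈))

  c⊆vertices : ∀ i → c i ⊆ vertices
  c⊆vertices i = subst (_⊆ vertices) (edge-toℕ i) (edge⊆verticesUpTo t (s≤s⁻¹ (Fin.toℕ<n i)))

  edge⊆vertices : ∀ a → edge a ⊆ vertices
  edge⊆vertices a = c⊆vertices (a mod k)

  ∈verticesUpTo⁻ : ∀ j → x ∈ verticesUpTo j → ∃ λ a → x ∈ edge a
  ∈verticesUpTo⁻ zero    x∈ = 0 , x∈
  ∈verticesUpTo⁻ (suc j) x∈ with x∈p∪q⁻ (verticesUpTo j) (edge (suc j)) x∈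
  ... | inj₁ x∈V = ∈verticesUpTo⁻ j x∈V
  ... | inj₂ x∈e = suc j , x∈e

  ∈vertices⁻ : x ∈ vertices → ∃ λ i → x ∈ c i
  ∈vertices⁻ x∈V = let (a , x∈a) = ∈verticesUpTo⁻ t x∈V in a mod k , x∈a

  ∣verticesUpTo∣≤3+2j : (∀ i → ∣ c i ∣ ≡ 3) → ∀ j → ∣ verticesUpTo j ∣ ≤ 3 + 2 * j
  ∣verticesUpTo∣≤3+2j ∣c∣≡3 zero    = ≤-reflexive (∣c∣≡3 (0 mod k))
  ∣verticesUpTo∣≤3+2j ∣c∣≡3 (suc j) = +-cancelʳ-≤ 1 _ _ (begin
    ∣ V ∪ e ∣ + 1          ≤⟨ +-monoʳ-≤ ∣ V ∪ e ∣ 1≤∣V∩e∣ ⟩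
    ∣ V ∪ e ∣ + ∣ V ∩ e ∣  ≡⟨ ∣p∪q∣+∣p∩q∣≡∣p∣+∣q∣ V e ⟩
    ∣ V ∣ + ∣ e ∣          ≡⟨ cong (∣ V ∣ +_) (∣c∣≡3 (suc j mod k)) ⟩
    ∣ V ∣ + 3              ≤⟨ +-monoˡ-≤ 3 (∣verticesUpTo∣≤3+2j ∣c∣≡3 j) ⟩
    3 + 2 * j + 3          ≡⟨ regroup j ⟩
    3 + 2 * suc j + 1      ∎)
    where
    open ≤-Reasoning
    V e : Subset n
    V = verticesUpTo j
    e = edge (suc j)
    1≤∣V∩e∣ : 1 ≤ ∣ V ∩ e ∣
    1≤∣V∩e∣ = begin
      1                       ≡⟨ subst (λ b → ∣ edge j ∩ edge b ∣ ≡ 1) (+-comm j 1) (∣edge∩edge[+1]∣≡1 j) ⟨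
      ∣ edge j ∩ e ∣          ≤⟨ p⊆q⇒∣p∣≤∣q∣ (λ x∈ → x∈p∩q⁺ (edge⊆verticesUpTo j ≤-refl (p∩q⊆p _ _ x∈) , p∩q⊆q _ _ x∈)) ⟩
      ∣ V ∩ e ∣               ∎
    regroup : ∀ j → 3 + 2 * j + 3 ≡ 3 + 2 * suc j + 1
    regroup = solve-∀

  ∣edge[+i]∩edge[+j]∣≡0 : ∀ a {i j} → suc i < j → j < t → ∣ edge (a + i) ∩ edge (a + j) ∣ ≡ 0
  ∣edge[+i]∩edge[+j]∣≡0 a {i} {j} 1+i<j j<t with m≤n⇒∃[o]m+o≡n 1+i<j
  ... | o , 2+i+o≡j = subst (λ b → ∣ edge (a + i) ∩ edge b ∣ ≡ 0) a+i+[2+o]≡a+j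
    (∣edge∩edge[+d]∣≡0 (a + i) (2 + o) (s≤s (s≤s z≤n)) (≤-<-trans 2+o≤j j<t))
    where
    a+i+[2+o]≡a+j : a + i + (2 + o) ≡ a + j
    a+i+[2+o]≡a+j = trans (+-assoc a i (2 + o))
      (cong (a +_) (trans (+-suc i (suc o)) (trans (cong suc (+-suc i o)) 2+i+o≡j)))
    2+o≤j : 2 + o ≤ j
    2+o≤j = subst (2 + o ≤_) 2+i+o≡j (+-monoˡ-≤ o (s≤s (s≤s z≤n)))

  module _ (H : Graph3 n) (c∈H : ∀ i → c i ∈E H) {g : Subset n} (g∈H : g ∈E H) where

    -- The path g, edge a, …, edge (a + t − 1) omits edge (a − 1), so it meets g only in edge a.
    private
      module Pendant (a : ℕ) {x : Fin n} (x∈g : x ∈ g) (x∈a : x ∈ edge a) (x∉a+1 : x ∉ edge (a + 1))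
                     (only-x : ∀ {y} b → y ∈ g → y ∈ edge b → y ≡ x) where

        x∉edge[a+i] : ∀ i → 1 ≤ i → i < t → x ∉ edge (a + i)
        x∉edge[a+i] 1             _ _   = x∉a+1
        x∉edge[a+i] (suc (suc i)) _ i<t = λ x∈a+i →
          ∣p∣≡0⇒x∉p (∣edge∩edge[+d]∣≡0 a (2 + i) (s≤s (s≤s z≤n)) i<t) (x∈p∩q⁺ (x∈a , x∈a+i))

        g∩edge⊆⁅x⁆ : ∀ b → g ∩ edge b ⊆ ⁅ x ⁆
        g∩edge⊆⁅x⁆ b y∈ = subst (_∈ ⁅ x ⁆) (sym (only-x b (p∩q⊆p _ _ y∈) (p∩q⊆q _ _ y∈))) (x∈⁅x⁆ x)

        path : Fin k → Subset n
        path zero    = g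
        path (suc i) = edge (a + toℕ i)

        path∈H : ∀ i → path i ∈E H
        path∈H zero    = g∈H
        path∈H (suc i) = c∈H _

        path-linear : IsLinearPath k path
        path-linear zero    (suc j) _ = meet , ¬meet
          where
          meet : PathAdj 0 (suc (toℕ j)) → ∣ g ∩ edge (a + toℕ j) ∣ ≡ 1
          meet 1+j≡1 rewrite suc-injective 1+j≡1 | +-identityʳ a =
            p⊆⁅x⁆∧x∈p⇒∣p∣≡1 (g∩edge⊆⁅x⁆ a) (x∈p∩q⁺ (x∈g , x∈a))
          ¬meet : ¬ PathAdj 0 (suc (toℕ j)) → ∣ g ∩ edge (a + toℕ j) ∣ ≡ 0
          ¬meet j≢0 = Empty⇒∣p∣≡0 λ (y , y∈) →
            x∉edge[a+i] (toℕ j) (n≢0⇒n>0 (j≢0 ∘ cong suc)) (Fin.toℕ<n j)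
              (subst (_∈ edge (a + toℕ j)) (x∈⁅y⁆⇒x≡y x (g∩edge⊆⁅x⁆ (a + toℕ j) y∈)) (p∩q⊆q g _ y∈))
        path-linear (suc i) (suc j) 1+i<1+j = meet , ¬meet
          where
          meet : PathAdj (suc (toℕ i)) (suc (toℕ j)) → ∣ edge (a + toℕ i) ∩ edge (a + toℕ j) ∣ ≡ 1
          meet 1+j≡2+i rewrite suc-injective 1+j≡2+i =
            subst (λ b → ∣ edge (a + toℕ i) ∩ edge b ∣ ≡ 1)
              (trans (+-assoc a (toℕ i) 1) (cong (a +_) (+-comm (toℕ i) 1)))
              (∣edge∩edge[+1]∣≡1 (a + toℕ i))
          ¬meet : ¬ PathAdj (suc (toℕ i)) (suc (toℕ j)) → ∣ edge (a + toℕ i) ∩ edge (a + toℕ j) ∣ ≡ 0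
          ¬meet j≢1+i = ∣edge[+i]∩edge[+j]∣≡0 a
            (≤∧≢⇒< (s≤s⁻¹ 1+i<1+j) (j≢1+i ∘ cong suc ∘ sym)) (Fin.toℕ<n j)

        linearPath : HasLinearPath H k
        linearPath = path , path∈H , path-linear

    meeting⇒linearPath : ∀ a {x} → x ∈ g → x ∈ edge a →
      (∀ {y} b → y ∈ g → y ∈ edge b → y ≡ x) → HasLinearPath H k
    meeting⇒linearPath a {x} x∈g x∈a only-x with x ∈? edge (a + 1)
    ... | no  x∉a+1 = Pendant.linearPath a x∈g x∈a x∉a+1 only-x
    ... | yes x∈a+1 = Pendant.linearPath (a + 1) x∈g x∈a+1 x∉a+2 only-x
      where
      x∉a+2 : x ∉ edge (a + 1 + 1)
      x∉a+2 x∈a+2 = ∣p∣≡0⇒x∉p (∣edge∩edge[+d]∣≡0 a 2 ≤-refl (<-≤-trans (s≤s (s≤s (s≤s z≤n))) t≥3))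
        (x∈p∩q⁺ (x∈a , subst (λ b → x ∈ edge b) (+-assoc a 1 1) x∈a+2))

    pendant⇒linearPath : ∣ g ∩ vertices ∣ ≡ 1 → HasLinearPath H k
    pendant⇒linearPath ∣g∩V∣≡1 with ∣p∣≡1⇒Nonempty ∣g∩V∣≡1
    ... | x , x∈g∩V with ∈verticesUpTo⁻ t (p∩q⊆q g vertices x∈g∩V)
    ...   | a , x∈a = meeting⇒linearPath a (p∩q⊆p g vertices x∈g∩V) x∈a λ b y∈g y∈b →
      ∣p∣≡1⇒x∈p⇒y∈p⇒x≡y ∣g∩V∣≡1 (x∈p∩q⁺ (y∈g , edge⊆vertices b y∈b)) x∈g∩V

replace-same : ∀ {k} (c : Fin k → Subset n) m f → replace c m f m ≡ f
replace-same c m f with m Fin.≟ m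
... | yes _   = refl
... | no  m≢m = contradiction refl m≢m

replace-cases : ∀ {k} (c : Fin k → Subset n) m f i → replace c m f i ≡ f ⊎ replace c m f i ≡ c i
replace-cases c m f i with i Fin.≟ m
... | yes _ = inj₁ refl
... | no  _ = inj₂ refl

replace∈E : ∀ {k} {H : Graph3 n} (c : Fin k → Subset n) m f →
  (∀ i → c i ∈E H) → f ∈E H → ∀ i → replace c m f i ∈E H
replace∈E c m f c∈H f∈H i with i Fin.≟ m
... | yes _ = f∈H
... | no  _ = c∈H i

module CplusDegree {t : ℕ} (t≥3 : 3 ≤ t) (H : Graph3 n) (no-path : ¬ HasLinearPath H (suc t))
  {c : Fin (suc t) → Subset n} {f : Subset n} {v : Fin n} {m : Fin (suc t)}
  (c∈H : ∀ i → c i ∈E H) (cyc : IsLinearCycle (suc t) c) (f∈H : f ∈E H) (v∈f : v ∈ f)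
  (v∉c : ∀ i → v ∉ c i) (∣f∩cm∣≡2 : ∣ f ∩ c m ∣ ≡ 2) (cyc′ : IsLinearCycle (suc t) (replace c m f))
  where

  private
    module C  = LinearCycle t≥3 c cyc
    module C′ = LinearCycle t≥3 (replace c m f) cyc′

  V : Subset n
  V = C.vertices

  ∣e∣≡3 : ∀ {e} → e ∈E H → ∣ e ∣ ≡ 3
  ∣e∣≡3 = All.lookup (size3 H)

  v∉V : v ∉ V
  v∉V v∈V = let (i , v∈ci) = C.∈vertices⁻ v∈V in v∉c i v∈ci

  f⊆cm∪⁅v⁆ : f ⊆ c m ∪ ⁅ v ⁆
  f⊆cm∪⁅v⁆ = ∣p─q∣≡1⇒p⊆q∪⁅x⁆ (∣e∩q∣≡2⇒∣e─q∣≡1 f (c m) (∣e∣≡3 f∈H) ∣f∩cm∣≡2) v∈f (v∉c m)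

  f⊆V∪⁅v⁆ : f ⊆ V ∪ ⁅ v ⁆
  f⊆V∪⁅v⁆ y∈f with x∈p∪q⁻ (c m) ⁅ v ⁆ (f⊆cm∪⁅v⁆ y∈f)
  ... | inj₁ y∈cm = x∈p∪q⁺ (inj₁ (C.c⊆vertices m y∈cm))
  ... | inj₂ y≡v  = x∈p∪q⁺ (inj₂ y≡v)

  V′⊆V∪⁅v⁆ : C′.vertices ⊆ V ∪ ⁅ v ⁆
  V′⊆V∪⁅v⁆ y∈V′ with C′.∈vertices⁻ y∈V′
  ... | i , y∈c′i with replace-cases c m f i
  ...   | inj₁ c′i≡f  = f⊆V∪⁅v⁆ (subst (_ ∈_) c′i≡f y∈c′i)
  ...   | inj₂ c′i≡ci = x∈p∪q⁺ (inj₁ (C.c⊆vertices i (subst (_ ∈_) c′i≡ci y∈c′i)))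

  ∣g∩V∣≡0⇒∣g∩V′∣≡1 : ∀ {g} → v ∈ g → ∣ g ∩ V ∣ ≡ 0 → ∣ g ∩ C′.vertices ∣ ≡ 1
  ∣g∩V∣≡0⇒∣g∩V′∣≡1 {g} v∈g ∣g∩V∣≡0 = p⊆⁅x⁆∧x∈p⇒∣p∣≡1 g∩V′⊆⁅v⁆
    (x∈p∩q⁺ (v∈g , C′.c⊆vertices m (subst (v ∈_) (sym (replace-same c m f)) v∈f)))
    where
    g∩V′⊆⁅v⁆ : g ∩ C′.vertices ⊆ ⁅ v ⁆
    g∩V′⊆⁅v⁆ y∈ with x∈p∪q⁻ V ⁅ v ⁆ (V′⊆V∪⁅v⁆ (p∩q⊆q g _ y∈))
    ... | inj₁ y∈V = contradiction (x∈p∩q⁺ (p∩q⊆p g _ y∈ , y∈V)) (∣p∣≡0⇒x∉p ∣g∩V∣≡0)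
    ... | inj₂ y≡v = y≡v

  ∣g∩V∣≡2 : ∀ {g} → g ∈E H → v ∈ g → ∣ g ∩ V ∣ ≡ 2
  ∣g∩V∣≡2 {g} g∈H v∈g with ∣ g ∩ V ∣ in ∣g∩V∣≡s
  ... | 0 = contradiction
    (C′.pendant⇒linearPath H (replace∈E {H = H} c m f c∈H f∈H) g∈H (∣g∩V∣≡0⇒∣g∩V′∣≡1 v∈g ∣g∩V∣≡s)) no-path
  ... | 1 = contradiction (C.pendant⇒linearPath H c∈H g∈H ∣g∩V∣≡s) no-path
  ... | 2 = refl
  ... | suc (suc (suc s)) = contradiction (subst (_< 3) ∣g∩V∣≡s ∣g∩V∣<3) λ { (s≤s (s≤s (s≤s ()))) }
    where
    ∣g∩V∣<3 : ∣ g ∩ V ∣ < 3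
    ∣g∩V∣<3 = subst (∣ g ∩ V ∣ <_) (∣e∣≡3 g∈H) (p⊂q⇒∣p∣<∣q∣ (p∩q⊆p g V , v , v∈g , v∉V ∘ p∩q⊆q g V))

  g⊆V∪⁅v⁆ : ∀ {g} → g ∈E H → v ∈ g → g ⊆ V ∪ ⁅ v ⁆
  g⊆V∪⁅v⁆ {g} g∈H v∈g = ∣p─q∣≡1⇒p⊆q∪⁅x⁆ (∣e∩q∣≡2⇒∣e─q∣≡1 g V (∣e∣≡3 g∈H) (∣g∩V∣≡2 g∈H v∈g)) v∈g v∉V

  edgesAt-v : List (Subset n)
  edgesAt-v = filter (v ∈?_) (edges H)

  ∈edgesAt-v⁻ : ∀ {g} → g List.∈ edgesAt-v → g ∈E H × v ∈ g
  ∈edgesAt-v⁻ = ∈-filter⁻ (v ∈?_)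

  ∩V⊆ : ∀ {g g′} → g List.∈ edgesAt-v → g′ List.∈ edgesAt-v → g ∩ V ≡ g′ ∩ V → g ⊆ g′
  ∩V⊆ {g} {g′} g∈ g′∈ g∩V≡g′∩V y∈g with ∈edgesAt-v⁻ g∈ | ∈edgesAt-v⁻ g′∈
  ... | g∈H , v∈g | _ , v∈g′ with x∈p∪q⁻ V ⁅ v ⁆ (g⊆V∪⁅v⁆ g∈H v∈g y∈g)
  ...   | inj₁ y∈V = p∩q⊆p g′ V (subst (_ ∈_) g∩V≡g′∩V (x∈p∩q⁺ (y∈g , y∈V)))
  ...   | inj₂ y≡v = subst (_∈ g′) (sym (x∈⁅y⁆⇒x≡y v y≡v)) v∈g′

  ∩V-injective : ∀ {g g′} → g List.∈ edgesAt-v → g′ List.∈ edgesAt-v → g ∩ V ≡ g′ ∩ V → g ≡ g′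
  ∩V-injective g∈ g′∈ g∩V≡g′∩V = ⊆-antisym (∩V⊆ g∈ g′∈ g∩V≡g′∩V) (∩V⊆ g′∈ g∈ (sym g∩V≡g′∩V))

  deg≤∣V∣C2 : deg H v ≤ ∣ V ∣ C 2
  deg≤∣V∣C2 = begin
    length edgesAt-v               ≡⟨ length-map (_∩ V) edgesAt-v ⟨
    length (map (_∩ V) edgesAt-v)  ≤⟨ length≤∣W∣Cr V 2 _ unique (All.map⁺ (All.tabulate two-in-V)) ⟩
    ∣ V ∣ C 2                      ∎
    where
    open ≤-Reasoning
    two-in-V : ∀ {g} → g List.∈ edgesAt-v → SubsetOfSize V 2 (g ∩ V)
    two-in-V g∈ = p∩q⊆q _ V , ∣g∩V∣≡2 (proj₁ (∈edgesAt-v⁻ g∈)) (proj₂ (∈edgesAt-v⁻ g∈))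
    unique : Unique (map (_∩ V) edgesAt-v)
    unique = Unique-map⁺-injectiveOn (_∩ V) ∩V-injective (filter⁺ (v ∈?_) (simple H))

  deg≤[3+2t]C2 : deg H v ≤ (3 + 2 * t) C 2
  deg≤[3+2t]C2 = ≤-trans deg≤∣V∣C2 (C-monoˡ-≤ 2 (C.∣verticesUpTo∣≤3+2j (λ i → ∣e∣≡3 (c∈H i)) t))

  2*deg≤[3+2t]² : 2 * deg H v ≤ (3 + 2 * t) * (3 + 2 * t)
  2*deg≤[3+2t]² = begin
    2 * deg H v                          ≤⟨ *-monoʳ-≤ 2 deg≤[3+2t]C2 ⟩
    2 * ((3 + 2 * t) C 2)                ≤⟨ m≤m+n _ (3 + 2 * t) ⟩
    2 * ((3 + 2 * t) C 2) + (3 + 2 * t)  ≡⟨ 2*nC2+n≡n*n (3 + 2 * t) ⟩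
    (3 + 2 * t) * (3 + 2 * t)            ∎
    where open ≤-Reasoning

a<X∸b+c : ∀ {a b c X} y r → X ≡ b + y → y + c ≡ suc (a + r) → a < X ∸ b + c
a<X∸b+c {a} {b} {c} y r refl y+c≡1+a+r =
  subst (λ z → a < z + c) (sym (m+n∸m≡n b y)) (subst (a <_) (sym y+c≡1+a+r) (s≤s (m≤m+n a r)))

-- Both branches of g2 have the shape X ∸ b + 12. Here t = 3 + s and n = 2t + 17 + m, and the cube
-- (3 + s) ^ 3 is spelled out as the product it unfolds to, which is the form the ring solver accepts.
[3+2t]²<g2-odd : ∀ s m → (3 + 2 * (3 + s)) * (3 + 2 * (3 + s))
  < (3 + s ∸ 1) * (2 * (3 + s) + 17 + m) + 3 * (3 + s) ^ 3 ∸ 9 * (3 + s) + 12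
[3+2t]²<g2-odd s m = a<X∸b+c {(3 + 2 * (3 + s)) * (3 + 2 * (3 + s))} {9 * (3 + s)} {12}
  {(3 + s ∸ 1) * (2 * (3 + s) + 17 + m) + 3 * (3 + s) ^ 3}
  (100 + 99 * s + 29 * s * s + 3 * s * s * s + 2 * m + s * m)
  (30 + 63 * s + 25 * s * s + 3 * s * s * s + 2 * m + s * m) (X≡ s m) (slack s m)
  where
  X≡ : ∀ s m → (2 + s) * (2 * (3 + s) + 17 + m) + 3 * ((3 + s) * ((3 + s) * ((3 + s) * 1)))
             ≡ 9 * (3 + s) + (100 + 99 * s + 29 * s * s + 3 * s * s * s + 2 * m + s * m)
  X≡ = solve-∀
  slack : ∀ s m → 100 + 99 * s + 29 * s * s + 3 * s * s * s + 2 * m + s * m + 12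
    ≡ suc ((3 + 2 * (3 + s)) * (3 + 2 * (3 + s)) + (30 + 63 * s + 25 * s * s + 3 * s * s * s + 2 * m + s * m))
  slack = solve-∀

[3+2t]²<g2-even : ∀ s m → (3 + 2 * (3 + s)) * (3 + 2 * (3 + s))
  < (3 + s ∸ 2) * (2 * (3 + s) + 17 + m) + 3 * (3 + s) ^ 3 ∸ 5 * (3 + s) + 12
[3+2t]²<g2-even s m = a<X∸b+c {(3 + 2 * (3 + s)) * (3 + 2 * (3 + s))} {5 * (3 + s)} {12}
  {(3 + s ∸ 2) * (2 * (3 + s) + 17 + m) + 3 * (3 + s) ^ 3}
  (89 + 101 * s + 29 * s * s + 3 * s * s * s + m + s * m)
  (19 + 65 * s + 25 * s * s + 3 * s * s * s + m + s * m) (X≡ s m) (slack s m)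
  where
  X≡ : ∀ s m → (1 + s) * (2 * (3 + s) + 17 + m) + 3 * ((3 + s) * ((3 + s) * ((3 + s) * 1)))
             ≡ 5 * (3 + s) + (89 + 101 * s + 29 * s * s + 3 * s * s * s + m + s * m)
  X≡ = solve-∀
  slack : ∀ s m → 89 + 101 * s + 29 * s * s + 3 * s * s * s + m + s * m + 12
    ≡ suc ((3 + 2 * (3 + s)) * (3 + 2 * (3 + s)) + (19 + 65 * s + 25 * s * s + 3 * s * s * s + m + s * m))
  slack = solve-∀

g2-odd : ∀ n t → t % 2 ≡ 1 → g2 n t ≡ (t ∸ 1) * n + 3 * t ^ 3 ∸ 9 * t + 12
g2-odd n t t%2≡1 rewrite t%2≡1 = refl

g2-even : ∀ n t → t % 2 ≢ 1 → g2 n t ≡ (t ∸ 2) * n + 3 * t ^ 3 ∸ 5 * t + 12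
g2-even n t t%2≢1 with t % 2 | t%2≢1
... | 0           | _     = refl
... | 1           | 1≢1   = contradiction refl 1≢1
... | suc (suc _) | _     = refl

[3+2t]²<g2 : ∀ t n → 3 ≤ t → 2 * t + 17 ≤ n → (3 + 2 * t) * (3 + 2 * t) < g2 n t
[3+2t]²<g2 t n 3≤t 2t+17≤n with m≤n⇒∃[o]m+o≡n 3≤t | m≤n⇒∃[o]m+o≡n 2t+17≤n
... | s , refl | m , refl with (3 + s) % 2 ≟ 1
... | yes odd  = subst (_ <_) (sym (g2-odd (2 * (3 + s) + 17 + m) (3 + s) odd)) ([3+2t]²<g2-odd s m)
... | no  even = subst (_ <_) (sym (g2-even (2 * (3 + s) + 17 + m) (3 + s) even)) ([3+2t]²<g2-even s m)

lemma2p2 : (t n : ℕ) → 3 ≤ t → 2 * t + 17 ≤ n → (H : Graph3 n) →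
    (∀ v → g2 n t ≤ 2 * deg H v) →
    ¬ HasLinearPath H (suc t) → ¬ HasCplus H (suc t)
lemma2p2 t n t≥3 n≥2t+17 H δ₁≥g no-path (c , f , v , m , c∈H , cyc , f∈H , v∈f , v∉c , ∣f∩cm∣≡2 , cyc′) =
  <⇒≱ ([3+2t]²<g2 t n t≥3 n≥2t+17) (≤-trans (δ₁≥g v) 2*deg≤[3+2t]²)
  where open CplusDegree t≥3 H no-path c∈H cyc f∈H v∈f v∉c ∣f∩cm∣≡2 cyc′
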